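{- Let $G$ be a connected multigraph with $m=|E(G)|\ge 1$ edges, edge weights $w_e\in\{ -1,1\}$, and let $k\ge -1$ be rational. Let $G'$ and $T$ be constructed from $(G,\mathbf{w})$ as described in the context, and let $\alpha=\max\{p/q : p,q \text{ integers},\ 0\le p\le |E(G')|,\ 1\le q\le |E(G')|,\ p/q<(k+2)/3\}$. Then every cut $(A',V(G')\setminus A')$ of $G'$ which separates two vertices of the same clique $c_v$ has $T$-thickness $|\delta_T(A')|/|\delta_{G'}(A')|$ lower than $\alpha$.
   Context: For a subgraph $S$ and vertex set $A$, $\delta_S(A)$ is the set of edges of $S$ with exactly one endpoint in $A$. Construction of $G'$: for each $v\in V(G)$ add a clique $c_v$ on $24m$ new vertices; for each edge $e=(v,w)$ of $G$, choose three pairs $(v_i,w_i)$, $i=0,1,2$, with $v_i\in c_v$, $w_i\in c_w$, all chosen vertices distinct from each other and from vertices chosen for other edges (so every vertex of $G'$ is incident to at most one edge between different cliques), and add the three edges $(v_i,w_i)$; call this set of three edges $d_e$. Construction of $T$: let $S$ be the spanning subgraph of $G'$ consisting of a path through all vertices of each clique $c_v$, together with, for each $e\in E(G)$, $w_e+2$ of the edges of $d_e$; then repeatedly, while the current subgraph contains a cycle, remove from it an edge of the cycle lying inside some clique; the result $T$ is a spanning tree of $G'$. -}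

module Defs where

open import Data.Nat as ℕ using (ℕ; zero; suc; _*_)
open import Data.Fin as Fin using (Fin; toℕ)
open import Data.Bool using (Bool; true; false; _∧_; _xor_; not; if_then_else_; T)
open import Data.Product using (Σ; _×_; _,_; proj₁; proj₂)
open import Data.Sum using (_⊎_)
open import Data.List using (List; []; _∷_; _++_; concatMap; map; length; foldr; upTo; allFin)
open import Data.Integer as ℤ using (ℤ; +_)
open import Data.Rational as ℚ using (ℚ; 0ℚ)
open import Data.Rational.Properties as ℚP using ()
open import Relation.Nullary using (¬_; does; yes; no)
open import Relation.Binary.PropositionalEquality using (_≡_; _≢_)

countB : {A : Set} → (A → Bool) → List A → ℕ
countB p []       = 0
countB p (x ∷ xs) = if p x then suc (countB p xs) else countB p xs

-- thickness t g = t / g  (as a rational; g = 0 never occurs in the lemma)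
thickness : ℕ → ℕ → ℚ
thickness t zero    = 0ℚ
thickness t (suc g) = (+ t) ℚ./ suc g

fracsBelow : ℕ → ℚ → List ℚ
fracsBelow N r =
  concatMap (λ q′ → concatMap (λ p →
      if does (((+ p) ℚ./ suc q′) ℚP.<? r) then ((+ p) ℚ./ suc q′) ∷ [] else [])
    (upTo (suc N))) (upTo N)

-- α = max { p/q : 0 ≤ p ≤ N, 1 ≤ q ≤ N, p/q < r }
-- (the set always contains 0/1 when N ≥ 1 and r > 0, so starting the fold
--  at 0 does not change the maximum)
alphaMax : ℕ → ℚ → ℚ
alphaMax N r = foldr ℚ._⊔_ 0ℚ (fracsBelow N r)

data GReach {n m : ℕ} (src tgt : Fin m → Fin n) : Fin n → Fin n → Set where
  here : ∀ {x} → GReach src tgt x x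
  fwd  : ∀ {z} (e : Fin m) → GReach src tgt (tgt e) z → GReach src tgt (src e) z
  bwd  : ∀ {z} (e : Fin m) → GReach src tgt (src e) z → GReach src tgt (tgt e) z

GConnected : {n m : ℕ} → (Fin m → Fin n) → (Fin m → Fin n) → Set
GConnected {n} src tgt = (x y : Fin n) → GReach src tgt x y

Loopless : {n m : ℕ} → (Fin m → Fin n) → (Fin m → Fin n) → Set
Loopless {m = m} src tgt = (e : Fin m) → src e ≢ tgt e

-- The construction of G' and T.
-- K = 24m is the clique size; a e i ∈ c_{src e}, b e i ∈ c_{tgt e} are the
-- endpoints v_i, w_i of the i-th edge of d_e.

module Construction (n m : ℕ) (src tgt : Fin m → Fin n)
                    (a b : Fin m → Fin 3 → Fin (24 * m)) where

  K : ℕ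
  K = 24 * m

  -- vertex (v , i) is the i-th vertex of clique c_v
  V′ : Set
  V′ = Fin n × Fin K

  data E′ : Set where
    cl : (v : Fin n) (i j : Fin K) → .(i Fin.< j) → E′
    dd : (e : Fin m) (t : Fin 3) → E′

  ends : E′ → V′ × V′
  ends (cl v i j _) = (v , i) , (v , j)
  ends (dd e t)     = (src e , a e t) , (tgt e , b e t)

  -- enumeration of E(G') (each edge exactly once)
  allE′ : List E′
  allE′ =
    concatMap (λ v → concatMap (λ i → concatMap (λ j → f v i j) (allFin K)) (allFin K)) (allFin n)
    ++ concatMap (λ e → map (dd e) (allFin 3)) (allFin m)
    where
    f : Fin n → Fin K → Fin K → List E′
    f v i j with i Fin.<? j
    ... | yes p = cl v i j p ∷ []
    ... | no  _ = []

  chosen : Fin m → Fin 3 → Fin 2 → V′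
  chosen e t Fin.zero       = src e , a e t
  chosen e t (Fin.suc _)    = tgt e , b e t

  ChoiceDistinct : Set
  ChoiceDistinct = ∀ e t s e′ t′ s′ → chosen e t s ≡ chosen e′ t′ s′
                   → (e , t , s) ≡ (e′ , t′ , s′)

  InClique : E′ → Set
  InClique (cl _ _ _ _) = Data.Unit.⊤ where import Data.Unit
  InClique (dd _ _)     = Data.Empty.⊥ where import Data.Empty

  -- spanning subgraphs of G' are given by their edge sets
  Subgraph : Set
  Subgraph = E′ → Bool

  fullG′ : Subgraph
  fullG′ _ = true

  crosses : (V′ → Bool) → E′ → Bool
  crosses A e = A (proj₁ (ends e)) xor A (proj₂ (ends e))

  δsize : Subgraph → (V′ → Bool) → ℕ
  δsize S A = countB (λ e → S e ∧ crosses A e) allE′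

  data Reach (P : E′ → Set) : V′ → V′ → Set where
    here : ∀ {x} → Reach P x x
    fwd  : ∀ {z} (e : E′) → P e → Reach P (proj₂ (ends e)) z → Reach P (proj₁ (ends e)) z
    bwd  : ∀ {z} (e : E′) → P e → Reach P (proj₁ (ends e)) z → Reach P (proj₂ (ends e)) z

  OnCycle : Subgraph → E′ → Set
  OnCycle S e = T (S e) × Reach (λ f → T (S f) × f ≢ e) (proj₁ (ends e)) (proj₂ (ends e))

  HasCycle : Subgraph → Set
  HasCycle S = Σ E′ (OnCycle S)

  Step : Subgraph → Subgraph → Set
  Step S S′ = Σ E′ λ e → InClique e × OnCycle S e × S′ e ≡ false
                         × (∀ f → f ≢ e → S′ f ≡ S f)

  data Reduces : Subgraph → Subgraph → Set where
    done : ∀ {S} → Reduces S S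
    step : ∀ {S S′ S″} → Step S S′ → Reduces S′ S″ → Reduces S S″

  -- i, j are consecutive on the Hamiltonian path π(0), π(1), …, π(K-1) of c_v
  Consecutive : (Fin K → Fin K) → Fin K → Fin K → Set
  Consecutive π i j = Σ (Fin K) λ l → Σ (Fin K) λ l′ → toℕ l′ ≡ suc (toℕ l)
                      × ((π l ≡ i × π l′ ≡ j) ⊎ (π l ≡ j × π l′ ≡ i))

  IsInitialS : (Fin n → Fin K → Fin K) → (Fin m → ℤ) → Subgraph → Set
  IsInitialS π w S =
    (∀ v i j (p : i Fin.< j) → (T (S (cl v i j p)) → Consecutive (π v) i j)
                             × (Consecutive (π v) i j → T (S (cl v i j p))))
    × (∀ e → countB (λ t → S (dd e t)) (allFin 3) ≡ ℤ.∣ w e ℤ.+ + 2 ∣)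

-- Inside a clique c_v the tree T keeps only edges of the Hamiltonian path of c_v, on which
-- every vertex has at most two neighbours.  If A′ splits c_v into s and s′ = 24m − s vertices,
-- T therefore has at most 2·min(s, s′) cut edges inside c_v, whereas G′ has s·s′ ≥ 12·min(s, s′)
-- of them.  Edges between cliques add at most 3m to δ_T(A′), and the clique separated by A′
-- alone contributes s·s′ ≥ s + s′ − 1 = 24m − 1 edges to δ_{G′}(A′).  Together these give
-- thickness below 3/10, and 3/10 is among the fractions below (k + 2)/3 ≥ 1/3 defining α.
module Submission where

open import Defs
open import Data.Nat using (ℕ; _*_; _≤_)
open import Data.Fin using (Fin)
open import Data.Bool using (Bool; true; false)
open import Data.Product using (Σ; _×_; _,_)
open import Data.Sum using (_⊎_)
open import Data.List using (length)
open import Data.Integer using (ℤ; 1ℤ; -1ℤ; +_)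
open import Data.Rational as ℚ using (ℚ)
open import Function.Definitions using (Injective)
open import Relation.Nullary using (¬_)
open import Relation.Binary.PropositionalEquality using (_≡_)

open import Data.Bool using (_∧_; _xor_; not; T; if_then_else_)
open import Data.Bool.Properties using (xor-comm; xor-same)
open import Data.Empty using (⊥-elim)
open import Data.Fin as Fin using (zero; suc; toℕ; _≟_)
open import Data.Fin.Properties as Fin using (any?; toℕ-injective)
import Data.Integer as ℤ
open import Data.Integer.Properties using (pos-*)
open import Data.List using (List; []; _∷_; _++_; concatMap; map; foldr; tabulate; allFin)
open import Data.List.Membership.Propositional using (_∈_; lose)
open import Data.List.Membership.Propositional.Properties using (∈-concatMap⁺; ∈-upTo⁺)
open import Data.List.Properties using (concatMap-cong)
open import Data.List.Relation.Unary.Any using (here; there)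
import Data.Nat as ℕ
open import Data.Nat using (zero; suc; _+_; _<_; z≤n; s≤s)
open import Data.Nat.Properties hiding (_≟_)
open import Data.Nat.Solver using (module +-*-Solver)
open import Algebra.Properties.Semiring.Sum +-*-semiring
  using (sum; sum-syntax; sum-cong-≗; ∑-comm; ∑-distrib-+; *-distribˡ-sum; *-distribʳ-sum)
open import Data.Product using (∃; ∃₂; proj₁)
open import Data.Rational using (0ℚ)
import Data.Rational.Properties as ℚ
open import Data.Rational.Unnormalised using (mkℚᵘ; *<*)
import Data.Rational.Unnormalised.Properties as ℚᵘ
open import Data.Sum using (inj₁; inj₂; swap)
open import Function using (_∘_)
open import Relation.Binary.Definitions using (tri<; tri≈; tri>)
open import Relation.Binary.PropositionalEquality
  using (refl; sym; trans; cong; cong₂; subst; subst₂; _≢_; module ≡-Reasoning)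
open import Relation.Nullary using (Dec; yes; no; does; _×-dec_; contradiction)
open import Relation.Nullary.Decidable using (dec-true; toWitness)

iverson : Bool → ℕ
iverson true  = 1
iverson false = 0

iverson-not : ∀ b → iverson b + iverson (not b) ≡ 1
iverson-not true  = refl
iverson-not false = refl

∑-mono-≤ : ∀ {n} {f g : Fin n → ℕ} → (∀ i → f i ≤ g i) → sum f ≤ sum g
∑-mono-≤ {zero}  f≤g = z≤n
∑-mono-≤ {suc n} f≤g = +-mono-≤ (f≤g zero) (∑-mono-≤ (f≤g ∘ suc))

term≤∑ : ∀ {n} (f : Fin n → ℕ) i → f i ≤ sum f
term≤∑ f zero    = m≤m+n (f zero) _
term≤∑ f (suc i) = ≤-trans (term≤∑ (f ∘ suc) i) (m≤n+m _ (f zero))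

∑-const : ∀ n c → ∑[ i < n ] c ≡ n * c
∑-const zero    c = refl
∑-const (suc n) c = cong (_+_ c) (∑-const n c)

∑-indicator : ∀ {n} (x : Fin n) → ∑[ j < n ] iverson (does (j ≟ x)) ≡ 1
∑-indicator {suc n} zero    = cong suc (trans (∑-const n 0) (*-zeroʳ n))
∑-indicator {suc n} (suc x) = ∑-indicator x

≡⊎≡⇒1≤ : ∀ {k} {j x y : Fin k} → j ≡ x ⊎ j ≡ y → 1 ≤ iverson (does (j ≟ x)) + iverson (does (j ≟ y))
≡⊎≡⇒1≤ {j = j}         (inj₁ refl) rewrite dec-true (j ≟ j) refl = s≤s z≤n
≡⊎≡⇒1≤ {j = j} {x = x} (inj₂ refl) rewrite dec-true (j ≟ j) refl = m≤n+m 1 (iverson (does (j ≟ x)))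

xor≡true⇒∨ : ∀ x y → x xor y ≡ true → x ≡ true ⊎ y ≡ true
xor≡true⇒∨ true  _    _ = inj₁ refl
xor≡true⇒∨ false true _ = inj₂ refl

xor≡true⇒not∨not : ∀ x y → x xor y ≡ true → not x ≡ true ⊎ not y ≡ true
xor≡true⇒not∨not false _     _ = inj₁ refl
xor≡true⇒not∨not true  false _ = inj₂ refl

iverson-xor : ∀ x y → iverson (x xor y) ≡ iverson x * iverson (not y) + iverson (not x) * iverson y
iverson-xor true  true  = refl
iverson-xor true  false = refl
iverson-xor false true  = refl
iverson-xor false false = refl

countB-singleton : ∀ {X : Set} (p : X → Bool) x → countB p (x ∷ []) ≡ iverson (p x)
countB-singleton p x with p x
... | true  = refl
... | false = refl

countB-++ : ∀ {X : Set} (p : X → Bool) xs ys → countB p (xs ++ ys) ≡ countB p xs + countB p ys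
countB-++ p []       ys = refl
countB-++ p (x ∷ xs) ys with p x
... | true  = cong suc (countB-++ p xs ys)
... | false = countB-++ p xs ys

countB≤length : ∀ {X : Set} (p : X → Bool) xs → countB p xs ≤ length xs
countB≤length p []       = z≤n
countB≤length p (x ∷ xs) with p x
... | true  = s≤s (countB≤length p xs)
... | false = m≤n⇒m≤1+n (countB≤length p xs)

countB-concatMap-tabulate : ∀ {X Y : Set} {n} (p : Y → Bool) (h : X → List Y) (f : Fin n → X) →
  countB p (concatMap h (tabulate f)) ≡ ∑[ i < n ] countB p (h (f i))
countB-concatMap-tabulate {n = zero}  p h f = refl
countB-concatMap-tabulate {n = suc n} p h f = begin
  countB p (h (f zero) ++ concatMap h (tabulate (f ∘ suc)))
    ≡⟨ countB-++ p (h (f zero)) _ ⟩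
  countB p (h (f zero)) + countB p (concatMap h (tabulate (f ∘ suc)))
    ≡⟨ cong (_+_ (countB p (h (f zero)))) (countB-concatMap-tabulate p h (f ∘ suc)) ⟩
  countB p (h (f zero)) + ∑[ i < n ] countB p (h (f (suc i))) ∎
  where open ≡-Reasoning

at-most-one⇒bounded : ∀ {n} {P : Fin n → Set} → (∀ i → Dec (P i)) → (∀ {i j} → P i → P j → i ≡ j) →
  Fin n → ∃ λ x → ∀ {i} → P i → i ≡ x
at-most-one⇒bounded P? unique default with any? P?
... | yes (x , Px) = x , λ Pi → unique Pi Px
... | no  ¬∃P      = default , λ {i} Pi → ⊥-elim (¬∃P (i , Pi))

module _ {k : ℕ} (π : Fin k → Fin k) where

  Follows : Fin k → Fin k → Set
  Follows i j = ∃₂ λ l l′ → toℕ l′ ≡ suc (toℕ l) × π l ≡ i × π l′ ≡ j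

  follows? : ∀ i j → Dec (Follows i j)
  follows? i j = any? λ l → any? λ l′ → (toℕ l′ ℕ.≟ suc (toℕ l)) ×-dec (π l ≟ i) ×-dec (π l′ ≟ j)

  module _ (π-injective : Injective _≡_ _≡_ π) where

    successor-unique : ∀ {i j j′} → Follows i j → Follows i j′ → j ≡ j′
    successor-unique (l , l′ , l′≡1+l , refl , refl) (m , m′ , m′≡1+m , πm≡πl , refl)
      with refl ← π-injective πm≡πl
      = cong π (toℕ-injective (trans l′≡1+l (sym m′≡1+m)))

    predecessor-unique : ∀ {i j j′} → Follows j i → Follows j′ i → j ≡ j′
    predecessor-unique (l , l′ , l′≡1+l , refl , refl) (m , m′ , m′≡1+m , refl , πm′≡πl′)
      with refl ← π-injective πm′≡πl′
      = cong π (toℕ-injective (suc-injective (trans (sym l′≡1+l) m′≡1+m)))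

    at-most-two-neighbours : ∀ i → ∃₂ λ x y → ∀ {j} → Follows i j ⊎ Follows j i → j ≡ x ⊎ j ≡ y
    at-most-two-neighbours i =
      let x , ≡x = at-most-one⇒bounded (follows? i) successor-unique i
          y , ≡y = at-most-one⇒bounded (λ j → follows? j i) predecessor-unique i
      in x , y , λ { (inj₁ i→j) → inj₁ (≡x i→j) ; (inj₂ j→i) → inj₂ (≡y j→i) }

private
  path-cut-bound-≤ : ∀ {t s s′} → 24 ≤ s + s′ → s ≤ s′ → t ≤ 2 * s → 6 * t ≤ s * s′
  path-cut-bound-≤ {t} {s} {s′} 24≤s+s′ s≤s′ t≤2s = begin
    6 * t        ≤⟨ *-monoʳ-≤ 6 t≤2s ⟩
    6 * (2 * s)  ≡⟨ *-assoc 6 2 s ⟨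
    12 * s       ≤⟨ *-monoˡ-≤ s 12≤s′ ⟩
    s′ * s       ≡⟨ *-comm s′ s ⟩
    s * s′       ∎
    where
    open ≤-Reasoning
    12≤s′ : 12 ≤ s′
    12≤s′ = *-cancelˡ-≤ 2 (begin
      24            ≤⟨ 24≤s+s′ ⟩
      s + s′        ≤⟨ +-monoˡ-≤ s′ s≤s′ ⟩
      s′ + s′       ≡⟨ cong (_+_ s′) (+-identityʳ s′) ⟨
      2 * s′        ∎)

path-cut-bound : ∀ {t s s′} → 24 ≤ s + s′ → t ≤ 2 * s → t ≤ 2 * s′ → 6 * t ≤ s * s′
path-cut-bound {t} {s} {s′} 24≤s+s′ t≤2s t≤2s′ with ≤-total s s′
... | inj₁ s≤s′ = path-cut-bound-≤ 24≤s+s′ s≤s′ t≤2s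
... | inj₂ s′≤s = subst (6 * t ≤_) (*-comm s′ s) (path-cut-bound-≤ (subst (24 ≤_) (+-comm s s′) 24≤s+s′) s′≤s t≤2s′)

+≤*+1 : ∀ {s s′} → 1 ≤ s → 1 ≤ s′ → s + s′ ≤ s * s′ + 1
+≤*+1 {suc x} {suc y} _ _ = begin
  suc x + suc y          ≤⟨ m≤m+n (suc x + suc y) (x * y) ⟩
  suc x + suc y + x * y  ≡⟨ solve 2 (λ x y → (con 1 :+ x) :+ (con 1 :+ y) :+ x :* y
                                       := (con 1 :+ x) :* (con 1 :+ y) :+ con 1) refl x y ⟩
  suc x * suc y + 1      ∎
  where
  open +-*-Solver
  open ≤-Reasoning

[t+d]*10<3*g : ∀ {t d c g m} → 1 ≤ m → 6 * t ≤ c → d ≤ 3 * m → 24 * m ≤ c + 1 → c ≤ g → (t + d) * 10 < 3 * g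
[t+d]*10<3*g {t} {d} {c} {g} {m} 1≤m 6t≤c d≤3m 24m≤c+1 c≤g = *-cancelˡ-< 3 _ _ (begin-strict
  3 * ((t + d) * 10)      ≡⟨ solve 2 (λ t d → con 3 :* ((t :+ d) :* con 10) := con 5 :* (con 6 :* t) :+ con 30 :* d) refl t d ⟩
  5 * (6 * t) + 30 * d    ≤⟨ +-mono-≤ (*-monoʳ-≤ 5 6t≤c) (*-monoʳ-≤ 30 d≤3m) ⟩
  5 * c + 30 * (3 * m)    ≡⟨ cong (_+_ (5 * c)) (*-assoc 30 3 m) ⟨
  5 * c + 90 * m          <⟨ +-monoʳ-< (5 * c) 90m<4c ⟩
  5 * c + 4 * c           ≡⟨ *-distribʳ-+ c 5 4 ⟨
  9 * c                   ≤⟨ *-monoʳ-≤ 9 c≤g ⟩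
  9 * g                   ≡⟨ *-assoc 3 3 g ⟩
  3 * (3 * g)             ∎)
  where
  open +-*-Solver
  open ≤-Reasoning
  [2+90m]+4≤4c+4 : (2 + 90 * m) + 4 ≤ 4 * c + 4
  [2+90m]+4≤4c+4 = begin
    (2 + 90 * m) + 4  ≡⟨ solve 1 (λ m → (con 2 :+ con 90 :* m) :+ con 4 := con 90 :* m :+ con 6) refl m ⟩
    90 * m + 6        ≤⟨ +-monoʳ-≤ (90 * m) (*-monoʳ-≤ 6 1≤m) ⟩
    90 * m + 6 * m    ≡⟨ solve 1 (λ m → con 90 :* m :+ con 6 :* m := con 4 :* (con 24 :* m)) refl m ⟩
    4 * (24 * m)      ≤⟨ *-monoʳ-≤ 4 24m≤c+1 ⟩
    4 * (c + 1)       ≡⟨ *-distribˡ-+ 4 c 1 ⟩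
    4 * c + 4         ∎
  90m<4c : 90 * m < 4 * c
  90m<4c = ≤-trans (n≤1+n _) (+-cancelʳ-≤ 4 (2 + 90 * m) (4 * c) [2+90m]+4≤4c+4)

3/10 : ℚ
3/10 = + 3 ℚ./ 10

thickness<3/10 : ∀ t g → t * 10 < 3 * g → thickness t g ℚ.< 3/10
thickness<3/10 t zero    t*10<0 = ⊥-elim (n≮0 t*10<0)
thickness<3/10 t (suc g) t*10<3g = ℚ.toℚᵘ-cancel-<
  (ℚᵘ.<-respˡ-≃ (ℚᵘ.≃-sym (ℚ.toℚᵘ-fromℚᵘ (mkℚᵘ (+ t) g)))
    (*<* (subst₂ ℤ._<_ (pos-* t 10) (pos-* 3 (suc g)) (ℤ.+<+ t*10<3g))))

∈⇒≤foldr-⊔ : ∀ {q xs} → q ∈ xs → q ℚ.≤ foldr ℚ._⊔_ 0ℚ xs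
∈⇒≤foldr-⊔ {xs = x ∷ xs} (here refl) = ℚ.p≤p⊔q x _
∈⇒≤foldr-⊔ {xs = x ∷ xs} (there q∈xs) = ℚ.≤-trans (∈⇒≤foldr-⊔ q∈xs) (ℚ.p≤q⊔p x _)

3/10≤alphaMax : ∀ {N r} → 10 ≤ N → 3/10 ℚ.< r → 3/10 ℚ.≤ alphaMax N r
3/10≤alphaMax {N} {r} 10≤N 3/10<r = ∈⇒≤foldr-⊔
  (∈-concatMap⁺ _ (lose (∈-upTo⁺ 10≤N)
    (∈-concatMap⁺ _ (lose (∈-upTo⁺ (s≤s (≤-trans (m≤m+n 3 7) 10≤N)))
      (kept (3/10 ℚ.<? r) 3/10<r)))))
  where
  kept : (d : Dec (3/10 ℚ.< r)) → 3/10 ℚ.< r → 3/10 ∈ (if does d then 3/10 ∷ [] else [])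
  kept (yes _)      _      = here refl
  kept (no 3/10≮r) 3/10<r = contradiction 3/10<r 3/10≮r

3/10<[k+2]/3 : ∀ k → (-1ℤ ℚ./ 1) ℚ.≤ k → 3/10 ℚ.< (k ℚ.+ (+ 2) ℚ./ 1) ℚ.* ((+ 1) ℚ./ 3)
3/10<[k+2]/3 k -1≤k = ℚ.<-≤-trans (toWitness {a? = 3/10 ℚ.<? ((+ 1) ℚ./ 3)} _)
  (ℚ.*-monoʳ-≤-nonNeg ((+ 1) ℚ./ 3) (ℚ.+-monoˡ-≤ ((+ 2) ℚ./ 1) -1≤k))

module Cuts (n m : ℕ) (src tgt : Fin m → Fin n) (a b : Fin m → Fin 3 → Fin (24 * m)) where
  open Construction n m src tgt a b

  cliqueEdges : Fin n → Fin K → Fin K → List E′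
  cliqueEdges v i j with i Fin.<? j
  ... | yes i<j = cl v i j i<j ∷ []
  ... | no  _   = []

  interEdges : List E′
  interEdges = concatMap (λ e → map (dd e) (allFin 3)) (allFin m)

  edgesOfClique : Fin n → List E′
  edgesOfClique v = concatMap (λ i → concatMap (cliqueEdges v i) (allFin K)) (allFin K)

  -- allE′ produces the clique edges with a function local to its definition in Defs, which
  -- cannot be named; the type of cliqueEdges-agree is therefore left to unification.
  mutual
    allE′-split : allE′ ≡ concatMap edgesOfClique (allFin n) ++ interEdges
    allE′-split = cong (_++ interEdges)
      (concatMap-cong (λ v → concatMap-cong (λ i → concatMap-cong (cliqueEdges-agree v i) (allFin K)) (allFin K)) (allFin n))

    cliqueEdges-agree : ∀ v i j → _
    cliqueEdges-agree v i j with i Fin.<? j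
    ... | yes _ = refl
    ... | no  _ = refl

  InCut : Subgraph → (V′ → Bool) → E′ → Bool
  InCut S A e = S e ∧ crosses A e

  cliqueCut : Subgraph → (V′ → Bool) → Fin n → ℕ
  cliqueCut S A v = ∑[ i < K ] ∑[ j < K ] countB (InCut S A) (cliqueEdges v i j)

  countB-edgesOfClique : ∀ S A v → countB (InCut S A) (edgesOfClique v) ≡ cliqueCut S A v
  countB-edgesOfClique S A v = trans (countB-concatMap-tabulate (InCut S A) (λ i → concatMap (cliqueEdges v i) (allFin K)) (λ i → i))
    (sum-cong-≗ λ i → countB-concatMap-tabulate (InCut S A) (cliqueEdges v i) (λ j → j))

  δsize-split : ∀ S A → δsize S A ≡ ∑[ v < n ] cliqueCut S A v + countB (InCut S A) interEdges
  δsize-split S A = begin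
    countB (InCut S A) allE′
      ≡⟨ cong (countB (InCut S A)) allE′-split ⟩
    countB (InCut S A) (concatMap edgesOfClique (allFin n) ++ interEdges)
      ≡⟨ countB-++ (InCut S A) (concatMap edgesOfClique (allFin n)) interEdges ⟩
    countB (InCut S A) (concatMap edgesOfClique (allFin n)) + countB (InCut S A) interEdges
      ≡⟨ cong (_+ countB (InCut S A) interEdges) (trans (countB-concatMap-tabulate (InCut S A) edgesOfClique (λ v → v))
           (sum-cong-≗ (countB-edgesOfClique S A))) ⟩
    ∑[ v < n ] cliqueCut S A v + countB (InCut S A) interEdges ∎
    where open ≡-Reasoning

  countB-interEdges≤3m : ∀ p → countB p interEdges ≤ 3 * m
  countB-interEdges≤3m p = begin
    countB p interEdges                                  ≡⟨ countB-concatMap-tabulate p (λ e → map (dd e) (allFin 3)) (λ e → e) ⟩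
    ∑[ e < m ] countB p (map (dd e) (allFin 3))          ≤⟨ ∑-mono-≤ (λ e → countB≤length p (map (dd e) (allFin 3))) ⟩
    ∑[ e < m ] 3                                         ≡⟨ ∑-const m 3 ⟩
    m * 3                                                ≡⟨ *-comm m 3 ⟩
    3 * m                                                ∎
    where open ≤-Reasoning

  edgeCount : Subgraph → Fin n → Fin K → Fin K → ℕ
  edgeCount S v i j = countB S (cliqueEdges v i j)

  degree : Subgraph → Fin n → Fin K → ℕ
  degree S v i = ∑[ j < K ] edgeCount S v i j + ∑[ j < K ] edgeCount S v j i

  OnPaths : Subgraph → (Fin n → Fin K → Fin K) → Set
  OnPaths S π = ∀ v i j (i<j : i Fin.< j) → T (S (cl v i j i<j)) → Consecutive (π v) i j

  consecutive⇒follows : ∀ {π i j} → Consecutive π i j → Follows π i j ⊎ Follows π j i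
  consecutive⇒follows (l , l′ , l′≡1+l , inj₁ (πl≡i , πl′≡j)) = inj₁ (l , l′ , l′≡1+l , πl≡i , πl′≡j)
  consecutive⇒follows (l , l′ , l′≡1+l , inj₂ (πl≡j , πl′≡i)) = inj₂ (l , l′ , l′≡1+l , πl≡j , πl′≡i)

  module _ {S : Subgraph} {π : Fin n → Fin K → Fin K} (onPaths : OnPaths S π) (v : Fin n) where

    edgeCount-pair≤ : ∀ {i x y} → (∀ {j} → Follows (π v) i j ⊎ Follows (π v) j i → j ≡ x ⊎ j ≡ y) →
      ∀ j → edgeCount S v i j + edgeCount S v j i ≤ iverson (does (j ≟ x)) + iverson (does (j ≟ y))
    edgeCount-pair≤ {i} neighbours j with i Fin.<? j | j Fin.<? i
    ... | yes i<j | yes j<i = ⊥-elim (Fin.<-asym i<j j<i)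
    ... | no  _   | no  _   = z≤n
    ... | yes i<j | no  _   with S (cl v i j i<j) in edge
    ...   | false = z≤n
    ...   | true  = ≡⊎≡⇒1≤ (neighbours (consecutive⇒follows (onPaths v i j i<j (subst T (sym edge) _))))
    edgeCount-pair≤ {i} neighbours j | no _ | yes j<i with S (cl v j i j<i) in edge
    ...   | false = z≤n
    ...   | true  = ≡⊎≡⇒1≤ (neighbours (swap (consecutive⇒follows (onPaths v j i j<i (subst T (sym edge) _)))))

    degree≤2 : Injective _≡_ _≡_ (π v) → ∀ i → degree S v i ≤ 2
    degree≤2 π-injective i with at-most-two-neighbours (π v) π-injective i
    ... | x , y , neighbours = begin
      ∑[ j < K ] edgeCount S v i j + ∑[ j < K ] edgeCount S v j i
        ≡⟨ ∑-distrib-+ (edgeCount S v i) (λ j → edgeCount S v j i) ⟨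
      ∑[ j < K ] (edgeCount S v i j + edgeCount S v j i)
        ≤⟨ ∑-mono-≤ (edgeCount-pair≤ neighbours) ⟩
      ∑[ j < K ] (iverson (does (j ≟ x)) + iverson (does (j ≟ y)))
        ≡⟨ ∑-distrib-+ (λ j → iverson (does (j ≟ x))) (λ j → iverson (does (j ≟ y))) ⟩
      ∑[ j < K ] iverson (does (j ≟ x)) + ∑[ j < K ] iverson (does (j ≟ y))
        ≡⟨ cong₂ _+_ (∑-indicator x) (∑-indicator y) ⟩
      2 ∎
      where open ≤-Reasoning

    cutCount≤ : ∀ A (q : Fin K → Bool) → (∀ i j → A (v , i) xor A (v , j) ≡ true → q i ≡ true ⊎ q j ≡ true) →
      ∀ i j → countB (InCut S A) (cliqueEdges v i j) ≤ iverson (q i) * edgeCount S v i j + iverson (q j) * edgeCount S v i j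
    cutCount≤ A q covers i j with i Fin.<? j
    ... | no  _   = z≤n
    ... | yes i<j with S (cl v i j i<j)
    ...   | false = z≤n
    ...   | true  with A (v , i) xor A (v , j) in crossing
    ...     | false = z≤n
    ...     | true  with covers i j crossing
    ...       | inj₁ qi rewrite qi = s≤s z≤n
    ...       | inj₂ qj rewrite qj = m≤n+m 1 _

    cliqueCut≤2*∑ : Injective _≡_ _≡_ (π v) → ∀ A (q : Fin K → Bool) →
      (∀ i j → A (v , i) xor A (v , j) ≡ true → q i ≡ true ⊎ q j ≡ true) →
      cliqueCut S A v ≤ 2 * ∑[ i < K ] iverson (q i)
    cliqueCut≤2*∑ π-injective A q covers = begin
      cliqueCut S A v
        ≤⟨ ∑-mono-≤ (λ i → ∑-mono-≤ (cutCount≤ A q covers i)) ⟩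
      ∑[ i < K ] ∑[ j < K ] (Q i * E i j + Q j * E i j)
        ≡⟨ sum-cong-≗ (λ i → ∑-distrib-+ (λ j → Q i * E i j) (λ j → Q j * E i j)) ⟩
      ∑[ i < K ] (∑[ j < K ] (Q i * E i j) + ∑[ j < K ] (Q j * E i j))
        ≡⟨ ∑-distrib-+ (λ i → ∑[ j < K ] (Q i * E i j)) (λ i → ∑[ j < K ] (Q j * E i j)) ⟩
      ∑[ i < K ] ∑[ j < K ] (Q i * E i j) + ∑[ i < K ] ∑[ j < K ] (Q j * E i j)
        ≡⟨ cong (_+_ (∑[ i < K ] ∑[ j < K ] (Q i * E i j))) (∑-comm (λ i j → Q j * E i j)) ⟩
      ∑[ i < K ] ∑[ j < K ] (Q i * E i j) + ∑[ i < K ] ∑[ j < K ] (Q i * E j i)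
        ≡⟨ ∑-distrib-+ (λ i → ∑[ j < K ] (Q i * E i j)) (λ i → ∑[ j < K ] (Q i * E j i)) ⟨
      ∑[ i < K ] (∑[ j < K ] (Q i * E i j) + ∑[ j < K ] (Q i * E j i))
        ≡⟨ sum-cong-≗ (λ i → trans (*-distribˡ-+ (Q i) _ _)
                                      (cong₂ _+_ (*-distribˡ-sum (Q i) (E i)) (*-distribˡ-sum (Q i) (λ j → E j i)))) ⟨
      ∑[ i < K ] (Q i * degree S v i)
        ≤⟨ ∑-mono-≤ (λ i → *-monoʳ-≤ (Q i) (degree≤2 π-injective i)) ⟩
      ∑[ i < K ] (Q i * 2)
        ≡⟨ *-distribʳ-sum 2 Q ⟨
      (∑[ i < K ] Q i) * 2
        ≡⟨ *-comm (∑[ i < K ] Q i) 2 ⟩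
      2 * ∑[ i < K ] Q i ∎
      where
      open ≤-Reasoning
      Q : Fin K → ℕ
      Q i = iverson (q i)
      E : Fin K → Fin K → ℕ
      E = edgeCount S v

  sizeIn sizeOut : (V′ → Bool) → Fin n → ℕ
  sizeIn  A v = ∑[ i < K ] iverson (A (v , i))
  sizeOut A v = ∑[ i < K ] iverson (not (A (v , i)))

  sizeIn+sizeOut : ∀ A v → sizeIn A v + sizeOut A v ≡ K
  sizeIn+sizeOut A v = begin
    sizeIn A v + sizeOut A v
      ≡⟨ ∑-distrib-+ (λ i → iverson (A (v , i))) (λ i → iverson (not (A (v , i)))) ⟨
    ∑[ i < K ] (iverson (A (v , i)) + iverson (not (A (v , i))))
      ≡⟨ sum-cong-≗ (λ i → iverson-not (A (v , i))) ⟩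
    ∑[ i < K ] 1
      ≡⟨ ∑-const K 1 ⟩
    K * 1
      ≡⟨ *-identityʳ K ⟩
    K ∎
    where open ≡-Reasoning

  cutCount-pair : ∀ A v i j → countB (InCut fullG′ A) (cliqueEdges v i j) + countB (InCut fullG′ A) (cliqueEdges v j i)
                              ≡ iverson (A (v , i) xor A (v , j))
  cutCount-pair A v i j with i Fin.<? j | j Fin.<? i
  ... | yes i<j | yes j<i = ⊥-elim (Fin.<-asym i<j j<i)
  ... | yes i<j | no  _   = trans (+-identityʳ _) (countB-singleton (InCut fullG′ A) (cl v i j i<j))
  ... | no  _   | yes j<i = trans (countB-singleton (InCut fullG′ A) (cl v j i j<i)) (cong iverson (xor-comm (A (v , j)) (A (v , i))))
  ... | no  i≮j | no  j≮i with Fin.<-cmp i j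
  ...   | tri< i<j _ _    = ⊥-elim (i≮j i<j)
  ...   | tri> _ _ j<i    = ⊥-elim (j≮i j<i)
  ...   | tri≈ _ refl _   = cong iverson (sym (xor-same (A (v , i))))

  cliqueCut-complete : ∀ A v → cliqueCut fullG′ A v ≡ sizeIn A v * sizeOut A v
  cliqueCut-complete A v = *-cancelˡ-≡ _ _ 2 (begin
    2 * C
      ≡⟨ cong (_+_ C) (+-identityʳ C) ⟩
    C + C
      ≡⟨ cong (_+_ C) (∑-comm c) ⟩
    ∑[ i < K ] ∑[ j < K ] c i j + ∑[ i < K ] ∑[ j < K ] c j i
      ≡⟨ ∑-distrib-+ (λ i → ∑[ j < K ] c i j) (λ i → ∑[ j < K ] c j i) ⟨
    ∑[ i < K ] (∑[ j < K ] c i j + ∑[ j < K ] c j i)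
      ≡⟨ sum-cong-≗ (λ i → ∑-distrib-+ (c i) (λ j → c j i)) ⟨
    ∑[ i < K ] ∑[ j < K ] (c i j + c j i)
      ≡⟨ sum-cong-≗ (λ i → sum-cong-≗ (λ j → trans (cutCount-pair A v i j) (iverson-xor (A (v , i)) (A (v , j))))) ⟩
    ∑[ i < K ] ∑[ j < K ] (In i * Out j + Out i * In j)
      ≡⟨ sum-cong-≗ (λ i → trans (∑-distrib-+ (λ j → In i * Out j) (λ j → Out i * In j))
                                  (sym (cong₂ _+_ (*-distribˡ-sum (In i) Out) (*-distribˡ-sum (Out i) In)))) ⟩
    ∑[ i < K ] (In i * sizeOut A v + Out i * sizeIn A v)
      ≡⟨ ∑-distrib-+ (λ i → In i * sizeOut A v) (λ i → Out i * sizeIn A v) ⟩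
    ∑[ i < K ] (In i * sizeOut A v) + ∑[ i < K ] (Out i * sizeIn A v)
      ≡⟨ cong₂ _+_ (*-distribʳ-sum (sizeOut A v) In) (*-distribʳ-sum (sizeIn A v) Out) ⟨
    sizeIn A v * sizeOut A v + sizeOut A v * sizeIn A v
      ≡⟨ cong (_+_ (sizeIn A v * sizeOut A v)) (trans (*-comm (sizeOut A v) (sizeIn A v)) (sym (+-identityʳ _))) ⟩
    2 * (sizeIn A v * sizeOut A v) ∎)
    where
    open ≡-Reasoning
    c : Fin K → Fin K → ℕ
    c i j = countB (InCut fullG′ A) (cliqueEdges v i j)
    C : ℕ
    C = cliqueCut fullG′ A v
    In Out : Fin K → ℕ
    In  i = iverson (A (v , i))
    Out i = iverson (not (A (v , i)))

  Step⇒⊆ : ∀ {S S′} → Step S S′ → ∀ f → T (S′ f) → T (S f)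
  Step⇒⊆ {S} (e , _ , _ , S′e≡false , unchanged) f f∈S′ with S f in Sf
  ... | true  = _
  ... | false = subst T (trans (unchanged f f≢e) Sf) f∈S′
    where
    f≢e : f ≢ e
    f≢e refl = subst T S′e≡false f∈S′

  Reduces⇒⊆ : ∀ {S S′} → Reduces S S′ → ∀ f → T (S′ f) → T (S f)
  Reduces⇒⊆ done        f f∈S′ = f∈S′
  Reduces⇒⊆ (step s r) f f∈S″ = Step⇒⊆ s f (Reduces⇒⊆ r f f∈S″)

  OnPaths-⊆ : ∀ {S S′ π} → (∀ f → T (S′ f) → T (S f)) → OnPaths S π → OnPaths S′ π
  OnPaths-⊆ S′⊆S onPaths v i j i<j e∈S′ = onPaths v i j i<j (S′⊆S (cl v i j i<j) e∈S′)

  6*cliqueCut≤cliqueCut-complete : ∀ {S π} → 1 ≤ m → OnPaths S π → ∀ v → Injective _≡_ _≡_ (π v) → ∀ A →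
    6 * cliqueCut S A v ≤ cliqueCut fullG′ A v
  6*cliqueCut≤cliqueCut-complete 1≤m onPaths v π-injective A = subst (6 * cliqueCut _ A v ≤_) (sym (cliqueCut-complete A v))
    (path-cut-bound {s = sizeIn A v} {s′ = sizeOut A v} 24≤K
      (cliqueCut≤2*∑ onPaths v π-injective A (λ i → A (v , i)) (λ i j → xor≡true⇒∨ (A (v , i)) (A (v , j))))
      (cliqueCut≤2*∑ onPaths v π-injective A (λ i → not (A (v , i))) (λ i j → xor≡true⇒not∨not (A (v , i)) (A (v , j)))))
    where
    24≤K : 24 ≤ sizeIn A v + sizeOut A v
    24≤K = subst (24 ≤_) (sym (sizeIn+sizeOut A v)) (*-monoʳ-≤ 24 1≤m)

  separated⇒24m≤cliqueCut-complete+1 : ∀ A {v i j} → A (v , i) ≡ true → A (v , j) ≡ false →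
    24 * m ≤ cliqueCut fullG′ A v + 1
  separated⇒24m≤cliqueCut-complete+1 A {v} {i} {j} i∈A j∉A = begin
    24 * m                        ≡⟨ sizeIn+sizeOut A v ⟨
    sizeIn A v + sizeOut A v      ≤⟨ +≤*+1 1≤sizeIn 1≤sizeOut ⟩
    sizeIn A v * sizeOut A v + 1  ≡⟨ cong (_+ 1) (cliqueCut-complete A v) ⟨
    cliqueCut fullG′ A v + 1      ∎
    where
    open ≤-Reasoning
    1≤sizeIn : 1 ≤ sizeIn A v
    1≤sizeIn = subst (λ b → iverson b ≤ sizeIn A v) i∈A (term≤∑ (λ l → iverson (A (v , l))) i)
    1≤sizeOut : 1 ≤ sizeOut A v
    1≤sizeOut = subst (λ b → iverson (not b) ≤ sizeOut A v) j∉A (term≤∑ (λ l → iverson (not (A (v , l)))) j)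

  module _ (1≤m : 1 ≤ m) (A : V′ → Bool) {v i j} (i∈A : A (v , i) ≡ true) (j∉A : A (v , j) ≡ false) where

    private
      complete : ℕ
      complete = ∑[ u < n ] cliqueCut fullG′ A u

      24m≤complete+1 : 24 * m ≤ complete + 1
      24m≤complete+1 = ≤-trans (separated⇒24m≤cliqueCut-complete+1 A i∈A j∉A)
                               (+-monoˡ-≤ 1 (term≤∑ (cliqueCut fullG′ A) v))

      complete≤δsize : complete ≤ δsize fullG′ A
      complete≤δsize = subst (complete ≤_) (sym (δsize-split fullG′ A)) (m≤m+n _ _)

    δsize*10<3*δsize-complete : ∀ {S π} → OnPaths S π → (∀ u → Injective _≡_ _≡_ (π u)) →
      δsize S A * 10 < 3 * δsize fullG′ A
    δsize*10<3*δsize-complete {S} onPaths π-injective = subst (λ t → t * 10 < 3 * δsize fullG′ A) (sym (δsize-split S A))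
      ([t+d]*10<3*g {t = ∑[ u < n ] cliqueCut S A u} 1≤m 6t≤complete (countB-interEdges≤3m (InCut S A)) 24m≤complete+1 complete≤δsize)
      where
      6t≤complete : 6 * ∑[ u < n ] cliqueCut S A u ≤ complete
      6t≤complete = ≤-trans (≤-reflexive (*-distribˡ-sum 6 (cliqueCut S A)))
        (∑-mono-≤ (λ u → 6*cliqueCut≤cliqueCut-complete 1≤m onPaths u (π-injective u) A))

    10≤length-allE′ : 10 ≤ length allE′
    10≤length-allE′ = ≤-trans 10≤complete (≤-trans complete≤δsize (countB≤length _ allE′))
      where
      10≤complete : 10 ≤ complete
      10≤complete = +-cancelʳ-≤ 1 10 complete (≤-trans (≤-trans (m≤m+n 11 13) (*-monoʳ-≤ 24 1≤m)) 24m≤complete+1)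

lemma2 : (n m : ℕ) (src tgt : Fin m → Fin n) → 1 ≤ m
  → Loopless src tgt → GConnected src tgt
  → (w : Fin m → ℤ) → (∀ e → w e ≡ 1ℤ ⊎ w e ≡ -1ℤ)
  → (k : ℚ) → (-1ℤ ℚ./ 1) ℚ.≤ k
  → (a b : Fin m → Fin 3 → Fin (24 * m))
  → let open Construction n m src tgt a b in
    ChoiceDistinct
  → (π : Fin n → Fin K → Fin K) → (∀ v → Injective _≡_ _≡_ (π v))
  → (S : Subgraph) → IsInitialS π w S
  → (Tr : Subgraph) → Reduces S Tr → ¬ HasCycle Tr
  → (A : V′ → Bool)
  → (Σ (Fin n) λ v → Σ (Fin K) λ i → Σ (Fin K) λ j → A (v , i) ≡ true × A (v , j) ≡ false)
  → thickness (δsize Tr A) (δsize fullG′ A)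
      ℚ.< alphaMax (length allE′) ((k ℚ.+ (+ 2) ℚ./ 1) ℚ.* ((+ 1) ℚ./ 3))
lemma2 n m src tgt 1≤m _ _ w _ k -1≤k a b _ π π-injective S S-initial Tr S↝Tr _ A (v , i , j , i∈A , j∉A) =
  ℚ.<-≤-trans (thickness<3/10 (δsize Tr A) (δsize fullG′ A) (δsize*10<3*δsize-complete 1≤m A i∈A j∉A Tr-onPaths π-injective))
              (3/10≤alphaMax (10≤length-allE′ 1≤m A i∈A j∉A) (3/10<[k+2]/3 k -1≤k))
  where
  open Construction n m src tgt a b
  open Cuts n m src tgt a b
  S-onPaths : OnPaths S π
  S-onPaths v i j i<j = proj₁ (proj₁ S-initial v i j i<j)
  Tr-onPaths : OnPaths Tr π
  Tr-onPaths = OnPaths-⊆ (Reduces⇒⊆ S↝Tr) S-onPaths
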